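{- For all $u,v\in\mathfrak{H}^0$ the following hold (i.e. the diagram built from these maps commutes): $$u\,{\sqcup\!\sqcup}_{ -1}\,v=\widetilde\tau\big(\widetilde\tau(u)\ast_{ -1}\widetilde\tau(v)\big),\qquad S(u\ast_{ -1}v)=S(u)\ast_1 S(v),\qquad \widetilde\tau(u\ast_1 v)=\widetilde\tau(u)\,{\sqcup\!\sqcup}_1\,\widetilde\tau(v).$$
   Context: Let $\mathfrak{H}:=\mathbb{Q}\langle p,y \rangle$ with unit $\mathbf{1}$; $\mathfrak{H}^1 := \mathbb{Q}\mathbf{1}\oplus \mathbb{Q}\langle p,y \rangle y$, $\mathfrak{H}^0:=\mathbb{Q}\mathbf{1}\oplus p\mathbb{Q}\langle p,y\rangle y$, $z_k:=p^ky$ ($k\in\mathbb{N}_0$). $\widetilde\tau$ is the involutive anti-automorphism with $\widetilde\tau(p)=y$, $\widetilde\tau(y)=p$. For $\lambda=\pm1$: the quasi-shuffle $\ast_\lambda$ on $\mathfrak{H}^1$: $\mathbf{1}\ast_\lambda w=w\ast_\lambda\mathbf{1}=w$, $z_n u \ast_{\lambda} z_m v = z_n (u \ast_{\lambda} z_m v) + z_m(z_n u \ast_{\lambda} v)+\lambda z_{n+m}(u\ast_{\lambda} v)$; the shuffle ${\sqcup\!\sqcup}_\lambda$: $\mathbf{1}\,{\sqcup\!\sqcup}_\lambda\, w = w\,{\sqcup\!\sqcup}_\lambda\, \mathbf{1}= w$, $yu \,{\sqcup\!\sqcup}_\lambda\, v= u\,{\sqcup\!\sqcup}_\lambda\, yv=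 y(u\,{\sqcup\!\sqcup}_\lambda\, v)$, $pu \,{\sqcup\!\sqcup}_\lambda\, pv=p(u \,{\sqcup\!\sqcup}_\lambda\, pv) + p(pu \,{\sqcup\!\sqcup}_\lambda\, v) + \lambda p(u\,{\sqcup\!\sqcup}_\lambda\, v)$. The map $S\colon\mathfrak{H}^1\to\mathfrak{H}^1$ (Ihara et al.) is defined by $S(\mathbf{1})=\mathbf{1}$, $S(z_kw)=z_kS(w)+z_k\circ S(w)$, where $z_{k}\circ\mathbf{1}=0$ and $z_{k_1}\circ(z_{k_2}w)=z_{k_1+k_2}w$; it is a linear isomorphism and an algebra isomorphism $(\mathfrak{H}^1,\ast_{ -1})\to(\mathfrak{H}^1,\ast_1)$. (The diagram has rows ${\sqcup\!\sqcup}_{ -1},\ast_{ -1},\ast_1,{\sqcup\!\sqcup}_1$ on $\mathfrak{H}^0\otimes\mathfrak{H}^0\to\mathfrak{H}^0$ connected by $\widetilde\tau\otimes\widetilde\tau$, $S\otimes S$, and $\widetilde\tau$, $S$.) -}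

module Defs where

open import Data.Nat using (ℕ; zero; suc) renaming (_+_ to _+ℕ_)
open import Data.Rational using (ℚ; 0ℚ; 1ℚ; _+_; _*_; -_)
open import Data.List using (List; []; _∷_; _++_; map; concatMap; reverse; _∷ʳ_)
open import Data.Product using (_×_; _,_; Σ)
open import Data.Sum using (_⊎_)
open import Data.Maybe using (Maybe; just; nothing)
open import Relation.Binary.PropositionalEquality using (_≡_; refl; _≢_)
open import Relation.Nullary using (yes; no; Dec)

data Letter : Set where
  p y : Letter

Word : Set
Word = List Letter

_≟L_ : (a b : Letter) → Dec (a ≡ b)
p ≟L p = yes refl
p ≟L y = no (λ ())
y ≟L p = no (λ ())
y ≟L y = yes refl

_≟W_ : (u v : Word) → Dec (u ≡ v)
[] ≟W [] = yes refl
[] ≟W (_ ∷ _) = no (λ ())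
(_ ∷ _) ≟W [] = no (λ ())
(a ∷ u) ≟W (b ∷ v) with a ≟L b | u ≟W v
... | yes refl | yes refl = yes refl
... | no a≢b | _ = no (λ { refl → a≢b refl })
... | yes _ | no u≢v = no (λ { refl → u≢v refl })

-- Elements of 𝔥 = ℚ⟨p,y⟩ as finite formal ℚ-linear combinations of words,
-- compared via their coefficient functions.

Poly : Set
Poly = List (ℚ × Word)

coeff : Poly → Word → ℚ
coeff [] w = 0ℚ
coeff ((c , u) ∷ f) w with u ≟W w
... | yes _ = c + coeff f w
... | no _ = coeff f w

infix 4 _≈_
_≈_ : Poly → Poly → Set
f ≈ g = ∀ w → coeff f w ≡ coeff g w

scaleL : {A : Set} → ℚ → List (ℚ × A) → List (ℚ × A)
scaleL a = map (λ { (c , w) → (a * c , w) })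

mapL : {A B : Set} → (A → B) → List (ℚ × A) → List (ℚ × B)
mapL f = map (λ { (c , w) → (c , f w) })

bilin : {A B : Set} → (A → A → List (ℚ × B)) → List (ℚ × A) → List (ℚ × A) → List (ℚ × B)
bilin op f g = concatMap (λ { (c , u) → concatMap (λ { (d , v) → scaleL (c * d) (op u v) }) g }) f

IsH0Word : Word → Set
IsH0Word w = (w ≡ []) ⊎ Σ Word (λ m → w ≡ p ∷ (m ∷ʳ y))

InH0 : Poly → Set
InH0 f = ∀ w → coeff f w ≢ 0ℚ → IsH0Word w

swap : Letter → Letter
swap p = y
swap y = p

τ̃w : Word → Word
τ̃w w = reverse (map swap w)

τ̃ : Poly → Poly
τ̃ = mapL τ̃w

-- 𝔥¹ : words in the z_k = p^k y.  A word z_{k₁}⋯z_{kₙ} is coded by the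
-- list k₁ ∷ … ∷ kₙ.

ZWord : Set
ZWord = List ℕ

toWord : ZWord → Word
toWord [] = []
toWord (k ∷ ks) = pk k (toWord ks)
  where
  pk : ℕ → Word → Word
  pk zero w = y ∷ w
  pk (suc n) w = p ∷ pk n w

mutual
  parse : Word → Maybe ZWord
  parse [] = just []
  parse (a ∷ w) = parseZ 0 (a ∷ w)

  parseZ : ℕ → Word → Maybe ZWord
  parseZ k [] = nothing
  parseZ k (p ∷ w) = parseZ (suc k) w
  parseZ k (y ∷ w) with parse w
  ... | just ks = just (k ∷ ks)
  ... | nothing = nothing

-- projection of an element of 𝔥 onto 𝔥¹ (drops words not in 𝔥¹;
-- only ever applied to elements of 𝔥¹ in the statement)
toH1 : Poly → List (ℚ × ZWord)
toH1 [] = []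
toH1 ((c , w) ∷ f) with parse w
... | just ks = (c , ks) ∷ toH1 f
... | nothing = toH1 f

fromH1 : List (ℚ × ZWord) → Poly
fromH1 = mapL toWord

qsh : ℚ → ZWord → ZWord → List (ℚ × ZWord)
qsh λ' [] v = (1ℚ , v) ∷ []
qsh λ' (n ∷ u) [] = (1ℚ , n ∷ u) ∷ []
qsh λ' (n ∷ u) (m ∷ v) =
  mapL (n ∷_) (qsh λ' u (m ∷ v))
  ++ mapL (m ∷_) (qsh λ' (n ∷ u) v)
  ++ scaleL λ' (mapL ((n +ℕ m) ∷_) (qsh λ' u v))

qshuffle : ℚ → Poly → Poly → Poly
qshuffle λ' f g = fromH1 (bilin (qsh λ') (toH1 f) (toH1 g))

sh : ℚ → Word → Word → Poly
sh λ' [] v = (1ℚ , v) ∷ []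
sh λ' (y ∷ u) v = mapL (y ∷_) (sh λ' u v)
sh λ' (p ∷ u) [] = (1ℚ , p ∷ u) ∷ []
sh λ' (p ∷ u) (y ∷ v) = mapL (y ∷_) (sh λ' (p ∷ u) v)
sh λ' (p ∷ u) (p ∷ v) =
  mapL (p ∷_) (sh λ' u (p ∷ v))
  ++ mapL (p ∷_) (sh λ' (p ∷ u) v)
  ++ scaleL λ' (mapL (p ∷_) (sh λ' u v))

shuffle : ℚ → Poly → Poly → Poly
shuffle λ' = bilin (sh λ')

circ : ℕ → List (ℚ × ZWord) → List (ℚ × ZWord)
circ k [] = []
circ k ((c , []) ∷ f) = circ k f
circ k ((c , k₂ ∷ w) ∷ f) = (c , (k +ℕ k₂) ∷ w) ∷ circ k f

Sz : ZWord → List (ℚ × ZWord)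
Sz [] = (1ℚ , []) ∷ []
Sz (k ∷ w) = mapL (k ∷_) (Sz w) ++ circ k (Sz w)

S : Poly → Poly
S f = fromH1 (concatMap (λ { (c , w) → scaleL c (Sz w) }) (toH1 f))

λ⁺ λ⁻ : ℚ
λ⁺ = 1ℚ
λ⁻ = - 1ℚ

-- Two elements of ℚ⟨p,y⟩ are equal once their pairings ⟪ φ ∣ _ ⟫ with every test function
-- φ : Word → ℚ agree, so all three identities are proved after pairing.  Pairing transposes the
-- recursive word operations into recursions on test functions (qshᵗ for ∗_λ, Sᵗ for S), which are
-- compared by induction on z-words.
--
-- For the τ̃-identities: τ̃ (z_{k₁} ⋯ z_{kₙ}) = p y^{kₙ} ⋯ p y^{k₁}, and the shuffle ⧢_λ of two such
-- words follows exactly the recursion of ∗_λ on the reversed index lists; the reversal is harmless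
-- because ∗_λ satisfies the same recursion read from the right.  For S, the diagonal term of ∗₋₁
-- is absorbed by an exchange law between R_a, R_b and ∗₁.  The hypothesis
-- u, v ∈ 𝔥⁰ is used only to know that u, v, τ̃ u and τ̃ v lie in 𝔥¹, where every word is toWord K
-- for a z-word K.

module Submission where

open import Defs
open import Data.Nat using (ℕ; zero; suc) renaming (_+_ to _+ℕ_)
import Data.Nat.Properties as ℕₚ
open import Algebra.Properties.CommutativeSemigroup ℕₚ.+-commutativeSemigroup using (interchange; x∙yz≈y∙xz; xy∙z≈xz∙y)
open import Data.Rational using (ℚ; 0ℚ; 1ℚ; _+_; _*_; -_)
open import Data.Rational.Properties using (_≟_; *-comm; *-identityʳ; *-zeroʳ; *-zeroˡ; +-identityˡ)
open import Data.Rational.Solver using (module +-*-Solver)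
open import Data.List using (List; []; _∷_; _++_; map; concatMap; reverse; _∷ʳ_; replicate)
open import Data.List.Properties using (++-assoc; ++-identityʳ; map-++; map-replicate; reverse-++; unfold-reverse)
open import Data.Maybe using (just; nothing; maybe′)
open import Data.Product using (_×_; _,_; Σ)
open import Data.Sum using (inj₁; inj₂)
open import Data.Empty using (⊥-elim)
open import Function using (_∘_)
open import Relation.Nullary using (yes; no)
open import Relation.Binary.PropositionalEquality
open +-*-Solver using (solve; _:=_; _:+_; _:*_; con)
open ≡-Reasoning

-- Pairing with test functions

⟪_∣_⟫ : {A : Set} → (A → ℚ) → List (ℚ × A) → ℚ
⟪ φ ∣ [] ⟫ = 0ℚ
⟪ φ ∣ (c , a) ∷ f ⟫ = c * φ a + ⟪ φ ∣ f ⟫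

module _ {A : Set} where

  ⟪∣⟫-++ : (φ : A → ℚ) (f g : List (ℚ × A)) → ⟪ φ ∣ f ++ g ⟫ ≡ ⟪ φ ∣ f ⟫ + ⟪ φ ∣ g ⟫
  ⟪∣⟫-++ φ [] g = sym (+-identityˡ _)
  ⟪∣⟫-++ φ ((c , a) ∷ f) g rewrite ⟪∣⟫-++ φ f g =
    solve 3 (λ x y z → x :+ (y :+ z) := (x :+ y) :+ z) refl (c * φ a) ⟪ φ ∣ f ⟫ ⟪ φ ∣ g ⟫

  ⟪∣⟫-scaleL : (φ : A → ℚ) (d : ℚ) (f : List (ℚ × A)) → ⟪ φ ∣ scaleL d f ⟫ ≡ d * ⟪ φ ∣ f ⟫
  ⟪∣⟫-scaleL φ d [] = sym (*-zeroʳ d)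
  ⟪∣⟫-scaleL φ d ((c , a) ∷ f) rewrite ⟪∣⟫-scaleL φ d f =
    solve 4 (λ d c x s → d :* c :* x :+ d :* s := d :* (c :* x :+ s)) refl d c (φ a) ⟪ φ ∣ f ⟫

  ⟪∣⟫-congˡ : {φ ψ : A → ℚ} → (∀ a → φ a ≡ ψ a) → (f : List (ℚ × A)) → ⟪ φ ∣ f ⟫ ≡ ⟪ ψ ∣ f ⟫
  ⟪∣⟫-congˡ φ≗ψ [] = refl
  ⟪∣⟫-congˡ φ≗ψ ((c , a) ∷ f) = cong₂ (λ x s → c * x + s) (φ≗ψ a) (⟪∣⟫-congˡ φ≗ψ f)

  ⟪∣⟫-+ˡ : (φ ψ : A → ℚ) (f : List (ℚ × A)) → ⟪ (λ a → φ a + ψ a) ∣ f ⟫ ≡ ⟪ φ ∣ f ⟫ + ⟪ ψ ∣ f ⟫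
  ⟪∣⟫-+ˡ φ ψ [] = sym (+-identityˡ 0ℚ)
  ⟪∣⟫-+ˡ φ ψ ((c , a) ∷ f) rewrite ⟪∣⟫-+ˡ φ ψ f =
    solve 5 (λ c x y s t → c :* (x :+ y) :+ (s :+ t) := (c :* x :+ s) :+ (c :* y :+ t)) refl
      c (φ a) (ψ a) ⟪ φ ∣ f ⟫ ⟪ ψ ∣ f ⟫

  ⟪∣⟫-*ˡ : (d : ℚ) (φ : A → ℚ) (f : List (ℚ × A)) → ⟪ (λ a → d * φ a) ∣ f ⟫ ≡ d * ⟪ φ ∣ f ⟫
  ⟪∣⟫-*ˡ d φ [] = sym (*-zeroʳ d)
  ⟪∣⟫-*ˡ d φ ((c , a) ∷ f) rewrite ⟪∣⟫-*ˡ d φ f =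
    solve 4 (λ d c x s → c :* (d :* x) :+ d :* s := d :* (c :* x :+ s)) refl d c (φ a) ⟪ φ ∣ f ⟫

module _ {A B : Set} where

  ⟪∣⟫-mapL : (φ : B → ℚ) (h : A → B) (f : List (ℚ × A)) → ⟪ φ ∣ mapL h f ⟫ ≡ ⟪ φ ∘ h ∣ f ⟫
  ⟪∣⟫-mapL φ h [] = refl
  ⟪∣⟫-mapL φ h ((c , a) ∷ f) = cong (c * φ (h a) +_) (⟪∣⟫-mapL φ h f)

  ⟪∣⟫-concatMap : (φ : B → ℚ) (ψ : A → ℚ) (F : ℚ × A → List (ℚ × B)) →
    (∀ c a → ⟪ φ ∣ F (c , a) ⟫ ≡ c * ψ a) → (f : List (ℚ × A)) →
    ⟪ φ ∣ concatMap F f ⟫ ≡ ⟪ ψ ∣ f ⟫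
  ⟪∣⟫-concatMap φ ψ F F-ψ [] = refl
  ⟪∣⟫-concatMap φ ψ F F-ψ ((c , a) ∷ f) =
    trans (⟪∣⟫-++ φ (F (c , a)) (concatMap F f)) (cong₂ _+_ (F-ψ c a) (⟪∣⟫-concatMap φ ψ F F-ψ f))

  ⟪∣⟫-bilin : (op : A → A → List (ℚ × B)) (φ : B → ℚ) (f g : List (ℚ × A)) →
    ⟪ φ ∣ bilin op f g ⟫ ≡ ⟪ (λ a → ⟪ (λ b → ⟪ φ ∣ op a b ⟫) ∣ g ⟫) ∣ f ⟫
  ⟪∣⟫-bilin op φ f g = ⟪∣⟫-concatMap φ _ _ row f
    where
    row : ∀ c a → ⟪ φ ∣ concatMap (λ { (d , b) → scaleL (c * d) (op a b) }) g ⟫ ≡ c * ⟪ (λ b → ⟪ φ ∣ op a b ⟫) ∣ g ⟫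
    row c a = trans (⟪∣⟫-concatMap φ (λ b → c * ⟪ φ ∣ op a b ⟫) _ entry g) (⟪∣⟫-*ˡ c _ g)
      where
      entry : ∀ d b → ⟪ φ ∣ scaleL (c * d) (op a b) ⟫ ≡ d * (c * ⟪ φ ∣ op a b ⟫)
      entry d b = trans (⟪∣⟫-scaleL φ (c * d) (op a b))
        (solve 3 (λ c d x → c :* d :* x := d :* (c :* x)) refl c d ⟪ φ ∣ op a b ⟫)

δ : Word → Word → ℚ
δ w u with u ≟W w
... | yes _ = 1ℚ
... | no _ = 0ℚ

coeff-as-⟪∣⟫ : (f : Poly) (w : Word) → coeff f w ≡ ⟪ δ w ∣ f ⟫
coeff-as-⟪∣⟫ [] w = refl
coeff-as-⟪∣⟫ ((c , u) ∷ f) w with u ≟W w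
... | yes _ = cong₂ _+_ (sym (*-identityʳ c)) (coeff-as-⟪∣⟫ f w)
... | no _ = trans (coeff-as-⟪∣⟫ f w) (sym (trans (cong (_+ ⟪ δ w ∣ f ⟫) (*-zeroʳ c)) (+-identityˡ _)))

≈-by-⟪∣⟫ : (f g : Poly) → (∀ φ → ⟪ φ ∣ f ⟫ ≡ ⟪ φ ∣ g ⟫) → f ≈ g
≈-by-⟪∣⟫ f g f≡g w = trans (coeff-as-⟪∣⟫ f w) (trans (f≡g (δ w)) (sym (coeff-as-⟪∣⟫ g w)))

vanishAt : Word → (Word → ℚ) → Word → ℚ
vanishAt u φ w with w ≟W u
... | yes _ = 0ℚ
... | no _ = φ w

⟪∣⟫-split-at : (u : Word) (φ : Word → ℚ) (f : Poly) →
  ⟪ φ ∣ f ⟫ ≡ coeff f u * φ u + ⟪ vanishAt u φ ∣ f ⟫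
⟪∣⟫-split-at u φ f = begin
  ⟪ φ ∣ f ⟫
    ≡⟨ ⟪∣⟫-congˡ split f ⟩
  ⟪ (λ w → φ u * δ u w + vanishAt u φ w) ∣ f ⟫
    ≡⟨ ⟪∣⟫-+ˡ _ _ f ⟩
  ⟪ (λ w → φ u * δ u w) ∣ f ⟫ + ⟪ vanishAt u φ ∣ f ⟫
    ≡⟨ cong (_+ ⟪ vanishAt u φ ∣ f ⟫) (⟪∣⟫-*ˡ (φ u) (δ u) f) ⟩
  φ u * ⟪ δ u ∣ f ⟫ + ⟪ vanishAt u φ ∣ f ⟫
    ≡⟨ cong (λ c → φ u * c + ⟪ vanishAt u φ ∣ f ⟫) (sym (coeff-as-⟪∣⟫ f u)) ⟩
  φ u * coeff f u + ⟪ vanishAt u φ ∣ f ⟫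
    ≡⟨ cong (_+ ⟪ vanishAt u φ ∣ f ⟫) (*-comm (φ u) (coeff f u)) ⟩
  coeff f u * φ u + ⟪ vanishAt u φ ∣ f ⟫ ∎
  where
  split : ∀ w → φ w ≡ φ u * δ u w + vanishAt u φ w
  split w with w ≟W u
  ... | yes refl = solve 1 (λ x → x := x :* con 1ℚ :+ con 0ℚ) refl (φ w)
  ... | no _ = solve 2 (λ x y → y := x :* con 0ℚ :+ y) refl (φ u) (φ w)

coeff-∷-≢ : (c : ℚ) (u w : Word) (f : Poly) → u ≢ w → coeff ((c , u) ∷ f) w ≡ coeff f w
coeff-∷-≢ c u w f u≢w with u ≟W w
... | yes u≡w = ⊥-elim (u≢w u≡w)
... | no _ = refl

coeff-∷-≡ : (c : ℚ) (u : Word) (f : Poly) → coeff ((c , u) ∷ f) u ≡ c + coeff f u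
coeff-∷-≡ c u f with u ≟W u
... | yes _ = refl
... | no u≢u = ⊥-elim (u≢u refl)

⟪∣⟫-∷-split : (c : ℚ) (u : Word) (φ : Word → ℚ) (f : Poly) →
  ⟪ φ ∣ (c , u) ∷ f ⟫ ≡ coeff ((c , u) ∷ f) u * φ u + ⟪ vanishAt u φ ∣ f ⟫
⟪∣⟫-∷-split c u φ f = begin
  c * φ u + ⟪ φ ∣ f ⟫
    ≡⟨ cong (c * φ u +_) (⟪∣⟫-split-at u φ f) ⟩
  c * φ u + (coeff f u * φ u + ⟪ vanishAt u φ ∣ f ⟫)
    ≡⟨ solve 4 (λ c k x s → c :* x :+ (k :* x :+ s) := (c :+ k) :* x :+ s) refl
        c (coeff f u) (φ u) ⟪ vanishAt u φ ∣ f ⟫ ⟩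
  (c + coeff f u) * φ u + ⟪ vanishAt u φ ∣ f ⟫
    ≡⟨ cong (λ k → k * φ u + ⟪ vanishAt u φ ∣ f ⟫) (sym (coeff-∷-≡ c u f)) ⟩
  coeff ((c , u) ∷ f) u * φ u + ⟪ vanishAt u φ ∣ f ⟫ ∎

-- Splitting off all occurrences of u at once exposes its total, possibly cancelled, coefficient.
⟪∣⟫-cong-support : (f : Poly) {φ ψ : Word → ℚ} → (∀ w → coeff f w ≢ 0ℚ → φ w ≡ ψ w) → ⟪ φ ∣ f ⟫ ≡ ⟪ ψ ∣ f ⟫
⟪∣⟫-cong-support [] φ≗ψ = refl
⟪∣⟫-cong-support ((c , u) ∷ f) {φ} {ψ} φ≗ψ = begin
  ⟪ φ ∣ (c , u) ∷ f ⟫                                    ≡⟨ ⟪∣⟫-∷-split c u φ f ⟩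
  coeff ((c , u) ∷ f) u * φ u + ⟪ vanishAt u φ ∣ f ⟫    ≡⟨ cong₂ _+_ at-u (⟪∣⟫-cong-support f off-u) ⟩
  coeff ((c , u) ∷ f) u * ψ u + ⟪ vanishAt u ψ ∣ f ⟫    ≡⟨ sym (⟪∣⟫-∷-split c u ψ f) ⟩
  ⟪ ψ ∣ (c , u) ∷ f ⟫                                    ∎
  where
  at-u : coeff ((c , u) ∷ f) u * φ u ≡ coeff ((c , u) ∷ f) u * ψ u
  at-u with coeff ((c , u) ∷ f) u ≟ 0ℚ
  ... | yes k≡0 rewrite k≡0 = trans (*-zeroˡ (φ u)) (sym (*-zeroˡ (ψ u)))
  ... | no k≢0 = cong (coeff ((c , u) ∷ f) u *_) (φ≗ψ u k≢0)
  off-u : ∀ w → coeff f w ≢ 0ℚ → vanishAt u φ w ≡ vanishAt u ψ w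
  off-u w k≢0 with w ≟W u
  ... | yes _ = refl
  ... | no w≢u = φ≗ψ w (λ k≡0 → k≢0 (trans (sym (coeff-∷-≢ c u w f (w≢u ∘ sym))) k≡0))

⟪∣⟫-cong-H0 : (f : Poly) → InH0 f → {φ ψ : Word → ℚ} → (∀ w → IsH0Word w → φ w ≡ ψ w) → ⟪ φ ∣ f ⟫ ≡ ⟪ ψ ∣ f ⟫
⟪∣⟫-cong-H0 f f∈H0 φ≗ψ = ⟪∣⟫-cong-support f (λ w k≢0 → φ≗ψ w (f∈H0 w k≢0))

pyWord : ZWord → Word
pyWord [] = []
pyWord (k ∷ K) = p ∷ (replicate k y ++ pyWord K)

replicate-+-++ : ∀ {A : Set} m n (a : A) w → replicate m a ++ (replicate n a ++ w) ≡ replicate (m +ℕ n) a ++ w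
replicate-+-++ zero n a w = refl
replicate-+-++ (suc m) n a w = cong (a ∷_) (replicate-+-++ m n a w)

replicate-++-∷ : ∀ {A : Set} k (a : A) w → replicate k a ++ (a ∷ w) ≡ a ∷ (replicate k a ++ w)
replicate-++-∷ zero a w = refl
replicate-++-∷ (suc k) a w = cong (a ∷_) (replicate-++-∷ k a w)

reverse-replicate : ∀ {A : Set} k (a : A) → reverse (replicate k a) ≡ replicate k a
reverse-replicate zero a = refl
reverse-replicate (suc k) a = begin
  reverse (a ∷ replicate k a)        ≡⟨ unfold-reverse a (replicate k a) ⟩
  reverse (replicate k a) ∷ʳ a       ≡⟨ cong (_∷ʳ a) (reverse-replicate k a) ⟩
  replicate k a ++ (a ∷ [])          ≡⟨ replicate-++-∷ k a [] ⟩
  a ∷ (replicate k a ++ [])          ≡⟨ cong (a ∷_) (++-identityʳ (replicate k a)) ⟩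
  a ∷ replicate k a                  ∎

τ̃w-++ : ∀ u v → τ̃w (u ++ v) ≡ τ̃w v ++ τ̃w u
τ̃w-++ u v = trans (cong reverse (map-++ swap u v)) (reverse-++ (map swap u) (map swap v))

τ̃w-involutive : ∀ w → τ̃w (τ̃w w) ≡ w
τ̃w-involutive [] = refl
τ̃w-involutive (a ∷ w) = begin
  τ̃w (τ̃w ((a ∷ []) ++ w))             ≡⟨ cong τ̃w (τ̃w-++ (a ∷ []) w) ⟩
  τ̃w (τ̃w w ++ (swap a ∷ []))          ≡⟨ τ̃w-++ (τ̃w w) (swap a ∷ []) ⟩
  swap (swap a) ∷ τ̃w (τ̃w w)           ≡⟨ cong₂ _∷_ (swap-involutive a) (τ̃w-involutive w) ⟩
  a ∷ w                               ∎
  where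
  swap-involutive : ∀ a → swap (swap a) ≡ a
  swap-involutive p = refl
  swap-involutive y = refl

τ̃w-replicate-p : ∀ k → τ̃w (replicate k p) ≡ replicate k y
τ̃w-replicate-p k = trans (cong reverse (map-replicate swap k p)) (reverse-replicate k y)

toWord-∷ : ∀ k K → toWord (k ∷ K) ≡ replicate k p ++ (y ∷ toWord K)
toWord-∷ zero K = refl
toWord-∷ (suc k) K = cong (p ∷_) (toWord-∷ k K)

pyWord-++ : ∀ A B → pyWord (A ++ B) ≡ pyWord A ++ pyWord B
pyWord-++ [] B = refl
pyWord-++ (a ∷ A) B = cong (p ∷_) (trans (cong (replicate a y ++_) (pyWord-++ A B))
  (sym (++-assoc (replicate a y) (pyWord A) (pyWord B))))

τ̃w-toWord : ∀ K → τ̃w (toWord K) ≡ pyWord (reverse K)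
τ̃w-toWord [] = refl
τ̃w-toWord (k ∷ K) = begin
  τ̃w (toWord (k ∷ K))
    ≡⟨ cong τ̃w (toWord-∷ k K) ⟩
  τ̃w (replicate k p ++ (y ∷ toWord K))
    ≡⟨ τ̃w-++ (replicate k p) (y ∷ toWord K) ⟩
  τ̃w ((y ∷ []) ++ toWord K) ++ τ̃w (replicate k p)
    ≡⟨ cong₂ _++_ (τ̃w-++ (y ∷ []) (toWord K)) (τ̃w-replicate-p k) ⟩
  (τ̃w (toWord K) ++ (p ∷ [])) ++ replicate k y
    ≡⟨ cong (λ w → (w ++ (p ∷ [])) ++ replicate k y) (τ̃w-toWord K) ⟩
  (pyWord (reverse K) ++ (p ∷ [])) ++ replicate k y
    ≡⟨ ++-assoc (pyWord (reverse K)) (p ∷ []) (replicate k y) ⟩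
  pyWord (reverse K) ++ (p ∷ replicate k y)
    ≡⟨ cong (λ w → pyWord (reverse K) ++ (p ∷ w)) (sym (++-identityʳ (replicate k y))) ⟩
  pyWord (reverse K) ++ pyWord (k ∷ [])
    ≡⟨ sym (pyWord-++ (reverse K) (k ∷ [])) ⟩
  pyWord (reverse K ∷ʳ k)
    ≡⟨ cong pyWord (sym (unfold-reverse k K)) ⟩
  pyWord (reverse (k ∷ K)) ∎

parseZ-p^k-y : ∀ j k w {K} → parse w ≡ just K → parseZ j (replicate k p ++ (y ∷ w)) ≡ just ((k +ℕ j) ∷ K)
parseZ-p^k-y j zero w parse-w rewrite parse-w = refl
parseZ-p^k-y j (suc k) w {K} parse-w =
  trans (parseZ-p^k-y (suc j) k w parse-w) (cong (λ i → just (i ∷ K)) (ℕₚ.+-suc k j))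

parse-toWord : ∀ K → parse (toWord K) ≡ just K
parse-toWord [] = refl
parse-toWord (k ∷ K) = begin
  parse (toWord (k ∷ K))                        ≡⟨ cong parse (toWord-∷ k K) ⟩
  parse (replicate k p ++ (y ∷ toWord K))       ≡⟨ parse-p^k-y k ⟩
  just ((k +ℕ 0) ∷ K)                           ≡⟨ cong (λ i → just (i ∷ K)) (ℕₚ.+-identityʳ k) ⟩
  just (k ∷ K)                                  ∎
  where
  -- parse reduces to parseZ 0 only once the word is known to be a cons.
  parse-p^k-y : ∀ k → parse (replicate k p ++ (y ∷ toWord K)) ≡ just ((k +ℕ 0) ∷ K)
  parse-p^k-y zero = parseZ-p^k-y 0 zero (toWord K) (parse-toWord K)
  parse-p^k-y (suc k) = parseZ-p^k-y 0 (suc k) (toWord K) (parse-toWord K)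

decodeAfter : ℕ → Word → ZWord
decodeAfter k [] = k ∷ []
decodeAfter k (p ∷ w) = decodeAfter (suc k) w
decodeAfter k (y ∷ w) = k ∷ decodeAfter 0 w

toWord-decodeAfter : ∀ k w → toWord (decodeAfter k w) ≡ replicate k p ++ (w ∷ʳ y)
toWord-decodeAfter k [] = toWord-∷ k []
toWord-decodeAfter k (p ∷ w) = trans (toWord-decodeAfter (suc k) w) (sym (replicate-++-∷ k p (w ∷ʳ y)))
toWord-decodeAfter k (y ∷ w) =
  trans (toWord-∷ k (decodeAfter 0 w)) (cong (λ v → replicate k p ++ (y ∷ v)) (toWord-decodeAfter 0 w))

H0-toWord : ∀ {w} → IsH0Word w → Σ ZWord (λ K → toWord K ≡ w)
H0-toWord (inj₁ refl) = [] , refl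
H0-toWord (inj₂ (m , refl)) = decodeAfter 1 m , toWord-decodeAfter 1 m

H0-τ̃w : ∀ {w} → IsH0Word w → IsH0Word (τ̃w w)
H0-τ̃w (inj₁ refl) = inj₁ refl
H0-τ̃w (inj₂ (m , refl)) = inj₂ (τ̃w m , trans (τ̃w-++ (p ∷ []) (m ∷ʳ y)) (cong (_++ (y ∷ [])) (τ̃w-++ m (y ∷ []))))

δ-τ̃w : ∀ w a → δ w (τ̃w a) ≡ δ (τ̃w w) a
δ-τ̃w w a with τ̃w a ≟W w | a ≟W τ̃w w
... | yes _ | yes _ = refl
... | no _ | no _ = refl
... | yes τ̃a≡w | no a≢τ̃w = ⊥-elim (a≢τ̃w (trans (sym (τ̃w-involutive a)) (cong τ̃w τ̃a≡w)))
... | no τ̃a≢w | yes a≡τ̃w = ⊥-elim (τ̃a≢w (trans (cong τ̃w a≡τ̃w) (τ̃w-involutive w)))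

coeff-τ̃ : ∀ f w → coeff (τ̃ f) w ≡ coeff f (τ̃w w)
coeff-τ̃ f w = begin
  coeff (τ̃ f) w          ≡⟨ coeff-as-⟪∣⟫ (τ̃ f) w ⟩
  ⟪ δ w ∣ τ̃ f ⟫          ≡⟨ ⟪∣⟫-mapL (δ w) τ̃w f ⟩
  ⟪ δ w ∘ τ̃w ∣ f ⟫       ≡⟨ ⟪∣⟫-congˡ (δ-τ̃w w) f ⟩
  ⟪ δ (τ̃w w) ∣ f ⟫       ≡⟨ sym (coeff-as-⟪∣⟫ f (τ̃w w)) ⟩
  coeff f (τ̃w w)         ∎

InH0-τ̃ : ∀ f → InH0 f → InH0 (τ̃ f)
InH0-τ̃ f f∈H0 w k≢0 =
  subst IsH0Word (τ̃w-involutive w) (H0-τ̃w (f∈H0 (τ̃w w) (λ k≡0 → k≢0 (trans (coeff-τ̃ f w) k≡0))))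

-- The transposed quasi-shuffle

qshᵗ : ℚ → (ZWord → ℚ) → ZWord → ZWord → ℚ
qshᵗ l φ [] v = φ v
qshᵗ l φ (n ∷ u) [] = φ (n ∷ u)
qshᵗ l φ (n ∷ u) (m ∷ v) =
  qshᵗ l (φ ∘ (n ∷_)) u (m ∷ v) + (qshᵗ l (φ ∘ (m ∷_)) (n ∷ u) v + l * qshᵗ l (φ ∘ ((n +ℕ m) ∷_)) u v)

1*x+0≡x : (x : ℚ) → 1ℚ * x + 0ℚ ≡ x
1*x+0≡x = solve 1 (λ x → con 1ℚ :* x :+ con 0ℚ := x) refl

⟪∣⟫-qsh : (l : ℚ) (φ : ZWord → ℚ) (u v : ZWord) → ⟪ φ ∣ qsh l u v ⟫ ≡ qshᵗ l φ u v
⟪∣⟫-qsh l φ [] v = 1*x+0≡x (φ v)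
⟪∣⟫-qsh l φ (n ∷ u) [] = 1*x+0≡x (φ (n ∷ u))
⟪∣⟫-qsh l φ (n ∷ u) (m ∷ v) = begin
  ⟪ φ ∣ mapL (n ∷_) (qsh l u (m ∷ v)) ++ (mapL (m ∷_) (qsh l (n ∷ u) v) ++ scaleL l (mapL ((n +ℕ m) ∷_) (qsh l u v))) ⟫
    ≡⟨ ⟪∣⟫-++ φ (mapL (n ∷_) (qsh l u (m ∷ v))) _ ⟩
  ⟪ φ ∣ mapL (n ∷_) (qsh l u (m ∷ v)) ⟫ + ⟪ φ ∣ mapL (m ∷_) (qsh l (n ∷ u) v) ++ scaleL l (mapL ((n +ℕ m) ∷_) (qsh l u v)) ⟫
    ≡⟨ cong (⟪ φ ∣ mapL (n ∷_) (qsh l u (m ∷ v)) ⟫ +_) (⟪∣⟫-++ φ (mapL (m ∷_) (qsh l (n ∷ u) v)) _) ⟩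
  ⟪ φ ∣ mapL (n ∷_) (qsh l u (m ∷ v)) ⟫
    + (⟪ φ ∣ mapL (m ∷_) (qsh l (n ∷ u) v) ⟫ + ⟪ φ ∣ scaleL l (mapL ((n +ℕ m) ∷_) (qsh l u v)) ⟫)
    ≡⟨ cong₂ _+_ (term n u (m ∷ v)) (cong₂ _+_ (term m (n ∷ u) v)
         (trans (⟪∣⟫-scaleL φ l (mapL ((n +ℕ m) ∷_) (qsh l u v))) (cong (l *_) (term (n +ℕ m) u v)))) ⟩
  qshᵗ l φ (n ∷ u) (m ∷ v) ∎
  where
  term : ∀ k u v → ⟪ φ ∣ mapL (k ∷_) (qsh l u v) ⟫ ≡ qshᵗ l (φ ∘ (k ∷_)) u v
  term k u v = trans (⟪∣⟫-mapL φ (k ∷_) (qsh l u v)) (⟪∣⟫-qsh l (φ ∘ (k ∷_)) u v)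

qshᵗ-congˡ : (l : ℚ) {φ ψ : ZWord → ℚ} → (∀ w → φ w ≡ ψ w) → ∀ u v → qshᵗ l φ u v ≡ qshᵗ l ψ u v
qshᵗ-congˡ l φ≗ψ [] v = φ≗ψ v
qshᵗ-congˡ l φ≗ψ (n ∷ u) [] = φ≗ψ (n ∷ u)
qshᵗ-congˡ l φ≗ψ (n ∷ u) (m ∷ v) =
  cong₂ _+_ (qshᵗ-congˡ l (φ≗ψ ∘ (n ∷_)) u (m ∷ v))
    (cong₂ _+_ (qshᵗ-congˡ l (φ≗ψ ∘ (m ∷_)) (n ∷ u) v) (cong (l *_) (qshᵗ-congˡ l (φ≗ψ ∘ ((n +ℕ m) ∷_)) u v)))

qshᵗ-+ˡ : ∀ l (φ ψ : ZWord → ℚ) u v → qshᵗ l (λ w → φ w + ψ w) u v ≡ qshᵗ l φ u v + qshᵗ l ψ u v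
qshᵗ-+ˡ l φ ψ [] v = refl
qshᵗ-+ˡ l φ ψ (n ∷ u) [] = refl
qshᵗ-+ˡ l φ ψ (n ∷ u) (m ∷ v)
  rewrite qshᵗ-+ˡ l (φ ∘ (n ∷_)) (ψ ∘ (n ∷_)) u (m ∷ v)
        | qshᵗ-+ˡ l (φ ∘ (m ∷_)) (ψ ∘ (m ∷_)) (n ∷ u) v
        | qshᵗ-+ˡ l (φ ∘ ((n +ℕ m) ∷_)) (ψ ∘ ((n +ℕ m) ∷_)) u v =
  solve 7 (λ l a b c d e f → (a :+ b) :+ ((c :+ d) :+ l :* (e :+ f)) := (a :+ (c :+ l :* e)) :+ (b :+ (d :+ l :* f))) refl
    l (qshᵗ l (φ ∘ (n ∷_)) u (m ∷ v)) (qshᵗ l (ψ ∘ (n ∷_)) u (m ∷ v))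
      (qshᵗ l (φ ∘ (m ∷_)) (n ∷ u) v) (qshᵗ l (ψ ∘ (m ∷_)) (n ∷ u) v)
      (qshᵗ l (φ ∘ ((n +ℕ m) ∷_)) u v) (qshᵗ l (ψ ∘ ((n +ℕ m) ∷_)) u v)

qshᵗ-[]ʳ : ∀ l φ u → qshᵗ l φ u [] ≡ φ u
qshᵗ-[]ʳ l φ [] = refl
qshᵗ-[]ʳ l φ (n ∷ u) = refl

qshᵗ-∷ʳ : ∀ l φ A B a b → qshᵗ l φ (A ∷ʳ a) (B ∷ʳ b) ≡
  qshᵗ l (φ ∘ (_∷ʳ a)) A (B ∷ʳ b) + (qshᵗ l (φ ∘ (_∷ʳ b)) (A ∷ʳ a) B + l * qshᵗ l (φ ∘ (_∷ʳ (a +ℕ b))) A B)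
qshᵗ-∷ʳ l φ [] [] a b =
  solve 4 (λ l x y z → x :+ (y :+ l :* z) := y :+ (x :+ l :* z)) refl l (φ (a ∷ b ∷ [])) (φ (b ∷ a ∷ [])) (φ ((a +ℕ b) ∷ []))
qshᵗ-∷ʳ l φ [] (x ∷ B) a b =
  trans (cong (λ t → X₁ + (t + l * X₄)) (qshᵗ-∷ʳ l (φ ∘ (x ∷_)) [] B a b))
    (solve 6 (λ l x₁ x₂ x₃ x₄ x₅ → x₁ :+ ((x₂ :+ (x₃ :+ l :* x₅)) :+ l :* x₄)
                                 := x₂ :+ ((x₁ :+ (x₃ :+ l :* x₄)) :+ l :* x₅)) refl
      l X₁ X₂ X₃ X₄ X₅)
  where
  X₁ = φ (a ∷ x ∷ (B ∷ʳ b))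
  X₂ = φ (x ∷ ((B ∷ʳ b) ∷ʳ a))
  X₃ = qshᵗ l (φ ∘ (x ∷_) ∘ (_∷ʳ b)) (a ∷ []) B
  X₄ = φ ((a +ℕ x) ∷ (B ∷ʳ b))
  X₅ = φ (x ∷ (B ∷ʳ (a +ℕ b)))
qshᵗ-∷ʳ l φ (x ∷ A) [] a b = begin
  qshᵗ l (φ ∘ (x ∷_)) (A ∷ʳ a) (b ∷ []) + (Y₄ + l * qshᵗ l (φ ∘ ((x +ℕ b) ∷_)) (A ∷ʳ a) [])
    ≡⟨ cong₂ (λ s t → s + (Y₄ + l * t)) (qshᵗ-∷ʳ l (φ ∘ (x ∷_)) A [] a b) (qshᵗ-[]ʳ l (φ ∘ ((x +ℕ b) ∷_)) (A ∷ʳ a)) ⟩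
  (Y₁ + (qshᵗ l (φ ∘ (x ∷_) ∘ (_∷ʳ b)) (A ∷ʳ a) [] + l * qshᵗ l (φ ∘ (x ∷_) ∘ (_∷ʳ (a +ℕ b))) A [])) + (Y₄ + l * Y₅)
    ≡⟨ cong₂ (λ s t → (Y₁ + (s + l * t)) + (Y₄ + l * Y₅))
         (qshᵗ-[]ʳ l (φ ∘ (x ∷_) ∘ (_∷ʳ b)) (A ∷ʳ a)) (qshᵗ-[]ʳ l (φ ∘ (x ∷_) ∘ (_∷ʳ (a +ℕ b))) A) ⟩
  (Y₁ + (Y₂ + l * Y₃)) + (Y₄ + l * Y₅)
    ≡⟨ solve 6 (λ l y₁ y₂ y₃ y₄ y₅ → (y₁ :+ (y₂ :+ l :* y₃)) :+ (y₄ :+ l :* y₅)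
                                  := (y₁ :+ (y₄ :+ l :* y₅)) :+ (y₂ :+ l :* y₃)) refl
         l Y₁ Y₂ Y₃ Y₄ Y₅ ⟩
  (Y₁ + (Y₄ + l * Y₅)) + (Y₂ + l * Y₃)
    ≡⟨ cong (λ t → (Y₁ + (Y₄ + l * t)) + (Y₂ + l * Y₃)) (sym (qshᵗ-[]ʳ l (φ ∘ ((x +ℕ b) ∷_) ∘ (_∷ʳ a)) A)) ⟩
  (Y₁ + (Y₄ + l * qshᵗ l (φ ∘ ((x +ℕ b) ∷_) ∘ (_∷ʳ a)) A [])) + (Y₂ + l * Y₃) ∎
  where
  Y₁ = qshᵗ l (φ ∘ (x ∷_) ∘ (_∷ʳ a)) A (b ∷ [])
  Y₂ = φ (x ∷ ((A ∷ʳ a) ∷ʳ b))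
  Y₃ = φ (x ∷ (A ∷ʳ (a +ℕ b)))
  Y₄ = φ (b ∷ x ∷ (A ∷ʳ a))
  Y₅ = φ ((x +ℕ b) ∷ (A ∷ʳ a))
qshᵗ-∷ʳ l φ (x ∷ A) (z ∷ B) a b =
  trans (cong₂ _+_ (qshᵗ-∷ʳ l (φ ∘ (x ∷_)) A (z ∷ B) a b)
          (cong₂ (λ s t → s + l * t) (qshᵗ-∷ʳ l (φ ∘ (z ∷_)) (x ∷ A) B a b) (qshᵗ-∷ʳ l (φ ∘ ((x +ℕ z) ∷_)) A B a b)))
  (solve 10 (λ l t₁ t₂ t₃ t₄ t₅ t₆ t₇ t₈ t₉ →
     (t₁ :+ (t₂ :+ l :* t₃)) :+ ((t₄ :+ (t₅ :+ l :* t₆)) :+ l :* (t₇ :+ (t₈ :+ l :* t₉)))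
     := (t₁ :+ (t₄ :+ l :* t₇)) :+ ((t₂ :+ (t₅ :+ l :* t₈)) :+ l :* (t₃ :+ (t₆ :+ l :* t₉)))) refl
     l (qshᵗ l (φ ∘ (x ∷_) ∘ (_∷ʳ a)) A ((z ∷ B) ∷ʳ b))
       (qshᵗ l (φ ∘ (x ∷_) ∘ (_∷ʳ b)) (A ∷ʳ a) (z ∷ B))
       (qshᵗ l (φ ∘ (x ∷_) ∘ (_∷ʳ (a +ℕ b))) A (z ∷ B))
       (qshᵗ l (φ ∘ (z ∷_) ∘ (_∷ʳ a)) (x ∷ A) (B ∷ʳ b))
       (qshᵗ l (φ ∘ (z ∷_) ∘ (_∷ʳ b)) ((x ∷ A) ∷ʳ a) B)
       (qshᵗ l (φ ∘ (z ∷_) ∘ (_∷ʳ (a +ℕ b))) (x ∷ A) B)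
       (qshᵗ l (φ ∘ ((x +ℕ z) ∷_) ∘ (_∷ʳ a)) A (B ∷ʳ b))
       (qshᵗ l (φ ∘ ((x +ℕ z) ∷_) ∘ (_∷ʳ b)) (A ∷ʳ a) B)
       (qshᵗ l (φ ∘ ((x +ℕ z) ∷_) ∘ (_∷ʳ (a +ℕ b))) A B))

qshᵗ-reverse : ∀ l φ A B → qshᵗ l φ (reverse A) (reverse B) ≡ qshᵗ l (φ ∘ reverse) A B
qshᵗ-reverse l φ [] B = refl
qshᵗ-reverse l φ (x ∷ A) [] = qshᵗ-[]ʳ l φ (reverse (x ∷ A))
qshᵗ-reverse l φ (x ∷ A) (z ∷ B) = begin
  qshᵗ l φ (reverse (x ∷ A)) (reverse (z ∷ B))
    ≡⟨ cong₂ (qshᵗ l φ) (unfold-reverse x A) (unfold-reverse z B) ⟩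
  qshᵗ l φ (reverse A ∷ʳ x) (reverse B ∷ʳ z)
    ≡⟨ qshᵗ-∷ʳ l φ (reverse A) (reverse B) x z ⟩
  qshᵗ l (φ ∘ (_∷ʳ x)) (reverse A) (reverse B ∷ʳ z)
    + (qshᵗ l (φ ∘ (_∷ʳ z)) (reverse A ∷ʳ x) (reverse B) + l * qshᵗ l (φ ∘ (_∷ʳ (x +ℕ z))) (reverse A) (reverse B))
    ≡⟨ cong₂ _+_ (peel x A (z ∷ B) refl (sym (unfold-reverse z B)) (qshᵗ-reverse l (φ ∘ (_∷ʳ x)) A (z ∷ B)))
         (cong₂ _+_ (peel z (x ∷ A) B (sym (unfold-reverse x A)) refl (qshᵗ-reverse l (φ ∘ (_∷ʳ z)) (x ∷ A) B))
           (cong (l *_) (peel (x +ℕ z) A B refl refl (qshᵗ-reverse l (φ ∘ (_∷ʳ (x +ℕ z))) A B)))) ⟩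
  qshᵗ l (φ ∘ reverse) (x ∷ A) (z ∷ B) ∎
  where
  peel : ∀ k A′ B′ {A″ B″} → A″ ≡ reverse A′ → B″ ≡ reverse B′ →
    qshᵗ l (φ ∘ (_∷ʳ k)) (reverse A′) (reverse B′) ≡ qshᵗ l (φ ∘ (_∷ʳ k) ∘ reverse) A′ B′ →
    qshᵗ l (φ ∘ (_∷ʳ k)) A″ B″ ≡ qshᵗ l (φ ∘ reverse ∘ (k ∷_)) A′ B′
  peel k A′ B′ refl refl ih = trans ih (qshᵗ-congˡ l (λ w → cong φ (sym (unfold-reverse k w))) A′ B′)

-- Shuffles of words p y^{k₁} p y^{k₂} ⋯

⟪∣⟫-sh-yˡ : ∀ l φ n u v → ⟪ φ ∣ sh l (replicate n y ++ u) v ⟫ ≡ ⟪ φ ∘ (replicate n y ++_) ∣ sh l u v ⟫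
⟪∣⟫-sh-yˡ l φ zero u v = refl
⟪∣⟫-sh-yˡ l φ (suc n) u v =
  trans (⟪∣⟫-mapL φ (y ∷_) (sh l (replicate n y ++ u) v)) (⟪∣⟫-sh-yˡ l (φ ∘ (y ∷_)) n u v)

⟪∣⟫-sh-yʳ : ∀ l φ n A v →
  ⟪ φ ∣ sh l (pyWord A) (replicate n y ++ v) ⟫ ≡ ⟪ φ ∘ (replicate n y ++_) ∣ sh l (pyWord A) v ⟫
⟪∣⟫-sh-yʳ l φ n [] v = refl
⟪∣⟫-sh-yʳ l φ zero (a ∷ A) v = refl
⟪∣⟫-sh-yʳ l φ (suc n) (a ∷ A) v =
  trans (⟪∣⟫-mapL φ (y ∷_) (sh l (pyWord (a ∷ A)) (replicate n y ++ v))) (⟪∣⟫-sh-yʳ l (φ ∘ (y ∷_)) n (a ∷ A) v)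

⟪∣⟫-sh-pyWord : ∀ l φ A B → ⟪ φ ∣ sh l (pyWord A) (pyWord B) ⟫ ≡ qshᵗ l (φ ∘ pyWord) A B
⟪∣⟫-sh-pyWord l φ [] B = 1*x+0≡x (φ (pyWord B))
⟪∣⟫-sh-pyWord l φ (a ∷ A) [] = 1*x+0≡x (φ (pyWord (a ∷ A)))
⟪∣⟫-sh-pyWord l φ (a ∷ A) (b ∷ B) = begin
  ⟪ φ ∣ mapL (p ∷_) (sh l U (p ∷ V)) ++ (mapL (p ∷_) (sh l (p ∷ U) V) ++ scaleL l (mapL (p ∷_) (sh l U V))) ⟫
    ≡⟨ ⟪∣⟫-++ φ (mapL (p ∷_) (sh l U (p ∷ V))) _ ⟩
  ⟪ φ ∣ mapL (p ∷_) (sh l U (p ∷ V)) ⟫ + ⟪ φ ∣ mapL (p ∷_) (sh l (p ∷ U) V) ++ scaleL l (mapL (p ∷_) (sh l U V)) ⟫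
    ≡⟨ cong (⟪ φ ∣ mapL (p ∷_) (sh l U (p ∷ V)) ⟫ +_) (⟪∣⟫-++ φ (mapL (p ∷_) (sh l (p ∷ U) V)) _) ⟩
  ⟪ φ ∣ mapL (p ∷_) (sh l U (p ∷ V)) ⟫ + (⟪ φ ∣ mapL (p ∷_) (sh l (p ∷ U) V) ⟫ + ⟪ φ ∣ scaleL l (mapL (p ∷_) (sh l U V)) ⟫)
    ≡⟨ cong₂ _+_ (left (⟪∣⟫-sh-pyWord l _ A (b ∷ B)))
         (cong₂ _+_ (right (⟪∣⟫-sh-pyWord l _ (a ∷ A) B))
           (trans (⟪∣⟫-scaleL φ l (mapL (p ∷_) (sh l U V))) (cong (l *_) (both (⟪∣⟫-sh-pyWord l _ A B))))) ⟩
  qshᵗ l (φ ∘ pyWord) (a ∷ A) (b ∷ B) ∎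
  where
  U = replicate a y ++ pyWord A
  V = replicate b y ++ pyWord B
  left : ⟪ φ ∘ (p ∷_) ∘ (replicate a y ++_) ∣ sh l (pyWord A) (pyWord (b ∷ B)) ⟫ ≡ qshᵗ l (φ ∘ pyWord ∘ (a ∷_)) A (b ∷ B) →
         ⟪ φ ∣ mapL (p ∷_) (sh l U (p ∷ V)) ⟫ ≡ qshᵗ l (φ ∘ pyWord ∘ (a ∷_)) A (b ∷ B)
  left ih = trans (⟪∣⟫-mapL φ (p ∷_) (sh l U (p ∷ V))) (trans (⟪∣⟫-sh-yˡ l (φ ∘ (p ∷_)) a (pyWord A) (p ∷ V)) ih)
  right : ⟪ φ ∘ (p ∷_) ∘ (replicate b y ++_) ∣ sh l (pyWord (a ∷ A)) (pyWord B) ⟫ ≡ qshᵗ l (φ ∘ pyWord ∘ (b ∷_)) (a ∷ A) B →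
          ⟪ φ ∣ mapL (p ∷_) (sh l (p ∷ U) V) ⟫ ≡ qshᵗ l (φ ∘ pyWord ∘ (b ∷_)) (a ∷ A) B
  right ih = trans (⟪∣⟫-mapL φ (p ∷_) (sh l (p ∷ U) V)) (trans (⟪∣⟫-sh-yʳ l (φ ∘ (p ∷_)) b (a ∷ A) (pyWord B)) ih)
  both : ⟪ φ ∘ (p ∷_) ∘ (replicate a y ++_) ∘ (replicate b y ++_) ∣ sh l (pyWord A) (pyWord B) ⟫
           ≡ qshᵗ l (φ ∘ (p ∷_) ∘ (replicate a y ++_) ∘ (replicate b y ++_) ∘ pyWord) A B →
         ⟪ φ ∣ mapL (p ∷_) (sh l U V) ⟫ ≡ qshᵗ l (φ ∘ pyWord ∘ ((a +ℕ b) ∷_)) A B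
  both ih = begin
    ⟪ φ ∣ mapL (p ∷_) (sh l U V) ⟫
      ≡⟨ ⟪∣⟫-mapL φ (p ∷_) (sh l U V) ⟩
    ⟪ φ ∘ (p ∷_) ∣ sh l U V ⟫
      ≡⟨ ⟪∣⟫-sh-yˡ l (φ ∘ (p ∷_)) a (pyWord A) V ⟩
    ⟪ φ ∘ (p ∷_) ∘ (replicate a y ++_) ∣ sh l (pyWord A) V ⟫
      ≡⟨ ⟪∣⟫-sh-yʳ l _ b A (pyWord B) ⟩
    ⟪ φ ∘ (p ∷_) ∘ (replicate a y ++_) ∘ (replicate b y ++_) ∣ sh l (pyWord A) (pyWord B) ⟫
      ≡⟨ ih ⟩
    qshᵗ l (φ ∘ (p ∷_) ∘ (replicate a y ++_) ∘ (replicate b y ++_) ∘ pyWord) A B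
      ≡⟨ qshᵗ-congˡ l (λ w → cong (φ ∘ (p ∷_)) (replicate-+-++ a b y (pyWord w))) A B ⟩
    qshᵗ l (φ ∘ pyWord ∘ ((a +ℕ b) ∷_)) A B ∎

-- The transposed map S

circᵗ : ℕ → (ZWord → ℚ) → ZWord → ℚ
circᵗ k φ [] = 0ℚ
circᵗ k φ (k′ ∷ w) = φ ((k +ℕ k′) ∷ w)

Rᵗ : ℕ → (ZWord → ℚ) → ZWord → ℚ
Rᵗ k φ w = φ (k ∷ w) + circᵗ k φ w

Sᵗ : (ZWord → ℚ) → ZWord → ℚ
Sᵗ φ [] = φ []
Sᵗ φ (k ∷ w) = Sᵗ (Rᵗ k φ) w

⟪∣⟫-circ : ∀ φ k f → ⟪ φ ∣ circ k f ⟫ ≡ ⟪ circᵗ k φ ∣ f ⟫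
⟪∣⟫-circ φ k [] = refl
⟪∣⟫-circ φ k ((c , []) ∷ f) =
  trans (⟪∣⟫-circ φ k f) (sym (trans (cong (_+ ⟪ circᵗ k φ ∣ f ⟫) (*-zeroʳ c)) (+-identityˡ _)))
⟪∣⟫-circ φ k ((c , k′ ∷ w) ∷ f) = cong (c * φ ((k +ℕ k′) ∷ w) +_) (⟪∣⟫-circ φ k f)

⟪∣⟫-Sz : ∀ φ w → ⟪ φ ∣ Sz w ⟫ ≡ Sᵗ φ w
⟪∣⟫-Sz φ [] = 1*x+0≡x (φ [])
⟪∣⟫-Sz φ (k ∷ w) = begin
  ⟪ φ ∣ mapL (k ∷_) (Sz w) ++ circ k (Sz w) ⟫              ≡⟨ ⟪∣⟫-++ φ (mapL (k ∷_) (Sz w)) (circ k (Sz w)) ⟩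
  ⟪ φ ∣ mapL (k ∷_) (Sz w) ⟫ + ⟪ φ ∣ circ k (Sz w) ⟫        ≡⟨ cong₂ _+_ (⟪∣⟫-mapL φ (k ∷_) (Sz w)) (⟪∣⟫-circ φ k (Sz w)) ⟩
  ⟪ φ ∘ (k ∷_) ∣ Sz w ⟫ + ⟪ circᵗ k φ ∣ Sz w ⟫               ≡⟨ sym (⟪∣⟫-+ˡ (φ ∘ (k ∷_)) (circᵗ k φ) (Sz w)) ⟩
  ⟪ Rᵗ k φ ∣ Sz w ⟫                                         ≡⟨ ⟪∣⟫-Sz (Rᵗ k φ) w ⟩
  Sᵗ (Rᵗ k φ) w                                             ∎

Sᵗ-congˡ : ∀ {φ ψ} → (∀ w → φ w ≡ ψ w) → ∀ u → Sᵗ φ u ≡ Sᵗ ψ u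
Sᵗ-congˡ φ≗ψ [] = φ≗ψ []
Sᵗ-congˡ {φ} {ψ} φ≗ψ (k ∷ u) = Sᵗ-congˡ Rᵗ-cong u
  where
  Rᵗ-cong : ∀ w → Rᵗ k φ w ≡ Rᵗ k ψ w
  Rᵗ-cong [] = cong (_+ 0ℚ) (φ≗ψ (k ∷ []))
  Rᵗ-cong (k′ ∷ w) = cong₂ _+_ (φ≗ψ (k ∷ k′ ∷ w)) (φ≗ψ ((k +ℕ k′) ∷ w))

Sᵗ-+ˡ : ∀ φ ψ u → Sᵗ (λ w → φ w + ψ w) u ≡ Sᵗ φ u + Sᵗ ψ u
Sᵗ-+ˡ φ ψ [] = refl
Sᵗ-+ˡ φ ψ (k ∷ u) = trans (Sᵗ-congˡ Rᵗ-+ u) (Sᵗ-+ˡ (Rᵗ k φ) (Rᵗ k ψ) u)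
  where
  Rᵗ-+ : ∀ w → Rᵗ k (λ w → φ w + ψ w) w ≡ Rᵗ k φ w + Rᵗ k ψ w
  Rᵗ-+ [] = solve 2 (λ x y → (x :+ y) :+ con 0ℚ := (x :+ con 0ℚ) :+ (y :+ con 0ℚ)) refl (φ (k ∷ [])) (ψ (k ∷ []))
  Rᵗ-+ (k′ ∷ w) = solve 4 (λ x y z t → (x :+ y) :+ (z :+ t) := (x :+ z) :+ (y :+ t)) refl
    (φ (k ∷ k′ ∷ w)) (ψ (k ∷ k′ ∷ w)) (φ ((k +ℕ k′) ∷ w)) (ψ ((k +ℕ k′) ∷ w))

Sᵗ-*ˡ : ∀ c φ u → Sᵗ (λ w → c * φ w) u ≡ c * Sᵗ φ u
Sᵗ-*ˡ c φ [] = refl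
Sᵗ-*ˡ c φ (k ∷ u) = trans (Sᵗ-congˡ Rᵗ-* u) (Sᵗ-*ˡ c (Rᵗ k φ) u)
  where
  Rᵗ-* : ∀ w → Rᵗ k (λ w → c * φ w) w ≡ c * Rᵗ k φ w
  Rᵗ-* [] = solve 2 (λ c x → c :* x :+ con 0ℚ := c :* (x :+ con 0ℚ)) refl c (φ (k ∷ []))
  Rᵗ-* (k′ ∷ w) = solve 3 (λ c x z → c :* x :+ c :* z := c :* (x :+ z)) refl c (φ (k ∷ k′ ∷ w)) (φ ((k +ℕ k′) ∷ w))

Sᵗ-0 : ∀ u → Sᵗ (λ _ → 0ℚ) u ≡ 0ℚ
Sᵗ-0 u = begin
  Sᵗ (λ _ → 0ℚ) u               ≡⟨ Sᵗ-congˡ (λ _ → sym (*-zeroˡ 0ℚ)) u ⟩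
  Sᵗ (λ _ → 0ℚ * 0ℚ) u          ≡⟨ Sᵗ-*ˡ 0ℚ (λ _ → 0ℚ) u ⟩
  0ℚ * Sᵗ (λ _ → 0ℚ) u          ≡⟨ *-zeroˡ (Sᵗ (λ _ → 0ℚ) u) ⟩
  0ℚ                            ∎

Rᵗ-Sᵗ-comm : ∀ a (H : ZWord → ZWord → ℚ) v K →
  Rᵗ a (λ K′ → Sᵗ (H K′) v) K ≡ Sᵗ (λ L → Rᵗ a (λ K′ → H K′ L) K) v
Rᵗ-Sᵗ-comm a H v [] = sym (trans (Sᵗ-+ˡ (H (a ∷ [])) (λ _ → 0ℚ) v) (cong (Sᵗ (H (a ∷ [])) v +_) (Sᵗ-0 v)))
Rᵗ-Sᵗ-comm a H v (c ∷ K) = sym (Sᵗ-+ˡ (H (a ∷ c ∷ K)) (H ((a +ℕ c) ∷ K)) v)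

Sᵗ-⟪∣⟫-comm : ∀ (H : ZWord → ZWord → ℚ) X K →
  Sᵗ (λ K′ → ⟪ H K′ ∣ X ⟫) K ≡ ⟪ (λ L → Sᵗ (λ K′ → H K′ L) K) ∣ X ⟫
Sᵗ-⟪∣⟫-comm H [] K = Sᵗ-0 K
Sᵗ-⟪∣⟫-comm H ((c , L) ∷ X) K =
  trans (Sᵗ-+ˡ (λ K′ → c * H K′ L) (λ K′ → ⟪ H K′ ∣ X ⟫) K)
    (cong₂ _+_ (Sᵗ-*ˡ c (λ K′ → H K′ L) K) (Sᵗ-⟪∣⟫-comm H X K))

qshᵗ⁺ : (ZWord → ℚ) → ZWord → ZWord → ℚ
qshᵗ⁺ = qshᵗ λ⁺

-- The merged head letters are only given up to equality, so that callers may rebracket them.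
qshᵗ⁺-Rᵗ : ∀ φ a c d x z {i j k} → a +ℕ c ≡ i → a +ℕ d ≡ j → a +ℕ (c +ℕ d) ≡ k →
  qshᵗ⁺ (Rᵗ a φ) (c ∷ x) (d ∷ z) ≡
    qshᵗ⁺ (φ ∘ (a ∷_)) (c ∷ x) (d ∷ z)
      + (qshᵗ⁺ (φ ∘ (i ∷_)) x (d ∷ z) + (qshᵗ⁺ (φ ∘ (j ∷_)) (c ∷ x) z + λ⁺ * qshᵗ⁺ (φ ∘ (k ∷_)) x z))
qshᵗ⁺-Rᵗ φ a c d x z refl refl refl = qshᵗ-+ˡ λ⁺ (φ ∘ (a ∷_)) (circᵗ a φ) (c ∷ x) (d ∷ z)

-- Transpose of  R_a (x ∗₁ R_b z) + R_b (R_a x ∗₁ z) = R_a x ∗₁ R_b z + R_{a+b} (x ∗₁ z),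
-- where R_k v = z_k v + z_k ∘ v, so that S (z_k w) = R_k (S w).
Rᵗ-qshᵗ⁺-exchange : ∀ φ a b x z →
  Rᵗ b (qshᵗ⁺ (Rᵗ a φ) x) z + Rᵗ a (λ x′ → qshᵗ⁺ (Rᵗ b φ) x′ z) x
    ≡ Rᵗ a (λ x′ → Rᵗ b (qshᵗ⁺ φ x′) z) x + qshᵗ⁺ (Rᵗ (a +ℕ b) φ) x z
Rᵗ-qshᵗ⁺-exchange φ a b [] [] = begin
  ((X₁ + X₃) + 0ℚ) + ((X₂ + φ ((b +ℕ a) ∷ [])) + 0ℚ)
    ≡⟨ cong (λ k → ((X₁ + X₃) + 0ℚ) + ((X₂ + φ (k ∷ [])) + 0ℚ)) (ℕₚ.+-comm b a) ⟩
  ((X₁ + X₃) + 0ℚ) + ((X₂ + X₃) + 0ℚ)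
    ≡⟨ solve 3 (λ x₁ x₂ x₃ → ((x₁ :+ x₃) :+ con 0ℚ) :+ ((x₂ :+ x₃) :+ con 0ℚ)
        := (((x₁ :+ (x₂ :+ con 1ℚ :* x₃)) :+ con 0ℚ) :+ con 0ℚ) :+ (x₃ :+ con 0ℚ)) refl X₁ X₂ X₃ ⟩
  (((X₁ + (X₂ + λ⁺ * X₃)) + 0ℚ) + 0ℚ) + (X₃ + 0ℚ) ∎
  where
  X₁ = φ (a ∷ b ∷ [])
  X₂ = φ (b ∷ a ∷ [])
  X₃ = φ ((a +ℕ b) ∷ [])
Rᵗ-qshᵗ⁺-exchange φ a b [] (d ∷ z) = begin
  ((P₁ + P₂) + (P₃ + P₄)) + (qshᵗ⁺ (Rᵗ b φ) (a ∷ []) (d ∷ z) + 0ℚ)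
    ≡⟨ cong (λ t → ((P₁ + P₂) + (P₃ + P₄)) + (t + 0ℚ)) (qshᵗ⁺-Rᵗ φ b a d [] z (ℕₚ.+-comm b a) refl (x∙yz≈y∙xz b a d)) ⟩
  ((P₁ + P₂) + (P₃ + P₄)) + ((P₅ + (P₂ + (P₆ + λ⁺ * P₄))) + 0ℚ)
    ≡⟨ solve 6 (λ p₁ p₂ p₃ p₄ p₅ p₆ → ((p₁ :+ p₂) :+ (p₃ :+ p₄)) :+ ((p₅ :+ (p₂ :+ (p₆ :+ con 1ℚ :* p₄))) :+ con 0ℚ)
         := (((p₁ :+ (p₅ :+ con 1ℚ :* p₂)) :+ (p₃ :+ (p₆ :+ con 1ℚ :* p₄))) :+ con 0ℚ) :+ (p₂ :+ p₄))
         refl P₁ P₂ P₃ P₄ P₅ P₆ ⟩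
  (((P₁ + (P₅ + λ⁺ * P₂)) + (P₃ + (P₆ + λ⁺ * P₄))) + 0ℚ) + (P₂ + P₄)
    ≡⟨ cong (λ k → (((P₁ + (P₅ + λ⁺ * P₂)) + (P₃ + (P₆ + λ⁺ * P₄))) + 0ℚ) + (P₂ + φ (k ∷ z))) (sym (ℕₚ.+-assoc a b d)) ⟩
  (((P₁ + (P₅ + λ⁺ * P₂)) + (P₃ + (P₆ + λ⁺ * P₄))) + 0ℚ) + (P₂ + φ (((a +ℕ b) +ℕ d) ∷ z)) ∎
  where
  P₁ = φ (a ∷ b ∷ d ∷ z)
  P₂ = φ ((a +ℕ b) ∷ d ∷ z)
  P₃ = φ (a ∷ (b +ℕ d) ∷ z)
  P₄ = φ ((a +ℕ (b +ℕ d)) ∷ z)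
  P₅ = qshᵗ⁺ (φ ∘ (b ∷_)) (a ∷ []) (d ∷ z)
  P₆ = qshᵗ⁺ (φ ∘ ((b +ℕ d) ∷_)) (a ∷ []) z
Rᵗ-qshᵗ⁺-exchange φ a b (c ∷ x) [] = begin
  (qshᵗ⁺ (Rᵗ a φ) (c ∷ x) (b ∷ []) + 0ℚ) + ((V₁ + φ ((b +ℕ a) ∷ c ∷ x)) + (V₃ + φ ((b +ℕ (a +ℕ c)) ∷ x)))
    ≡⟨ cong₂ (λ s t → (s + 0ℚ) + t) (qshᵗ⁺-Rᵗ φ a c b x [] refl refl (sym (ℕₚ.+-assoc a c b)))
         (cong₂ (λ s t → (V₁ + s) + (V₃ + t)) (cong (λ k → φ (k ∷ c ∷ x)) (ℕₚ.+-comm b a))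
           (trans (cong (λ k → φ (k ∷ x)) (ℕₚ.+-comm b (a +ℕ c))) (sym (qshᵗ-[]ʳ λ⁺ (φ ∘ (n ∷_)) x)))) ⟩
  ((U₁ + (U₂ + (V₂ + λ⁺ * W))) + 0ℚ) + ((V₁ + V₂) + (V₃ + W))
    ≡⟨ solve 6 (λ u₁ u₂ v₁ v₂ v₃ w → ((u₁ :+ (u₂ :+ (v₂ :+ con 1ℚ :* w))) :+ con 0ℚ) :+ ((v₁ :+ v₂) :+ (v₃ :+ w))
         := (((u₁ :+ (v₁ :+ con 1ℚ :* v₂)) :+ con 0ℚ) :+ ((u₂ :+ (v₃ :+ con 1ℚ :* w)) :+ con 0ℚ)) :+ (v₂ :+ w))
         refl U₁ U₂ V₁ V₂ V₃ W ⟩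
  (((U₁ + (V₁ + λ⁺ * V₂)) + 0ℚ) + ((U₂ + (V₃ + λ⁺ * W)) + 0ℚ)) + (V₂ + W)
    ≡⟨ cong (λ t → (((U₁ + (V₁ + λ⁺ * V₂)) + 0ℚ) + ((U₂ + (V₃ + λ⁺ * W)) + 0ℚ)) + (V₂ + t))
         (trans (qshᵗ-[]ʳ λ⁺ (φ ∘ (n ∷_)) x) (cong (λ k → φ (k ∷ x)) (sym (xy∙z≈xz∙y a b c)))) ⟩
  (((U₁ + (V₁ + λ⁺ * V₂)) + 0ℚ) + ((U₂ + (V₃ + λ⁺ * W)) + 0ℚ)) + (V₂ + φ (((a +ℕ b) +ℕ c) ∷ x)) ∎
  where
  n = (a +ℕ c) +ℕ b
  U₁ = qshᵗ⁺ (φ ∘ (a ∷_)) (c ∷ x) (b ∷ [])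
  U₂ = qshᵗ⁺ (φ ∘ ((a +ℕ c) ∷_)) x (b ∷ [])
  V₁ = φ (b ∷ a ∷ c ∷ x)
  V₂ = φ ((a +ℕ b) ∷ c ∷ x)
  V₃ = φ (b ∷ (a +ℕ c) ∷ x)
  W = qshᵗ⁺ (φ ∘ (n ∷_)) x []
Rᵗ-qshᵗ⁺-exchange φ a b (c ∷ x) (d ∷ z) = begin
  (qshᵗ⁺ (Rᵗ a φ) (c ∷ x) (b ∷ d ∷ z) + qshᵗ⁺ (Rᵗ a φ) (c ∷ x) ((b +ℕ d) ∷ z))
    + (qshᵗ⁺ (Rᵗ b φ) (a ∷ c ∷ x) (d ∷ z) + qshᵗ⁺ (Rᵗ b φ) ((a +ℕ c) ∷ x) (d ∷ z))
    ≡⟨ cong₂ _+_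
         (cong₂ _+_ (qshᵗ⁺-Rᵗ φ a c b x (d ∷ z) refl refl (sym (ℕₚ.+-assoc a c b)))
                    (qshᵗ⁺-Rᵗ φ a c (b +ℕ d) x z refl refl (sym (ℕₚ.+-assoc a c (b +ℕ d)))))
         (cong₂ _+_ (qshᵗ⁺-Rᵗ φ b a d (c ∷ x) z (ℕₚ.+-comm b a) refl (x∙yz≈y∙xz b a d))
                    (qshᵗ⁺-Rᵗ φ b (a +ℕ c) d x z (ℕₚ.+-comm b (a +ℕ c)) refl (x∙yz≈y∙xz b (a +ℕ c) d))) ⟩
  ((T₁ + (T₇ + (T₃ + λ⁺ * T₉))) + (T₄ + (T₁₀ + (T₆ + λ⁺ * T₁₂))))
    + ((T₂ + (T₃ + (T₅ + λ⁺ * T₆))) + (T₈ + (T₉ + (T₁₁ + λ⁺ * T₁₂))))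
    ≡⟨ solve 12 (λ t₁ t₂ t₃ t₄ t₅ t₆ t₇ t₈ t₉ t₁₀ t₁₁ t₁₂ →
         ((t₁ :+ (t₇ :+ (t₃ :+ con 1ℚ :* t₉))) :+ (t₄ :+ (t₁₀ :+ (t₆ :+ con 1ℚ :* t₁₂))))
           :+ ((t₂ :+ (t₃ :+ (t₅ :+ con 1ℚ :* t₆))) :+ (t₈ :+ (t₉ :+ (t₁₁ :+ con 1ℚ :* t₁₂))))
         := (((t₁ :+ (t₂ :+ con 1ℚ :* t₃)) :+ (t₄ :+ (t₅ :+ con 1ℚ :* t₆)))
              :+ ((t₇ :+ (t₈ :+ con 1ℚ :* t₉)) :+ (t₁₀ :+ (t₁₁ :+ con 1ℚ :* t₁₂))))
           :+ (t₃ :+ (t₉ :+ (t₆ :+ con 1ℚ :* t₁₂)))) refl T₁ T₂ T₃ T₄ T₅ T₆ T₇ T₈ T₉ T₁₀ T₁₁ T₁₂ ⟩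
  products + (T₃ + (T₉ + (T₆ + λ⁺ * T₁₂)))
    ≡⟨ cong (products +_) (sym (qshᵗ⁺-Rᵗ φ (a +ℕ b) c d x z (xy∙z≈xz∙y a b c) (ℕₚ.+-assoc a b d) (interchange a b c d))) ⟩
  products + qshᵗ⁺ (Rᵗ (a +ℕ b) φ) (c ∷ x) (d ∷ z) ∎
  where
  T₁ = qshᵗ⁺ (φ ∘ (a ∷_)) (c ∷ x) (b ∷ d ∷ z)
  T₂ = qshᵗ⁺ (φ ∘ (b ∷_)) (a ∷ c ∷ x) (d ∷ z)
  T₃ = qshᵗ⁺ (φ ∘ ((a +ℕ b) ∷_)) (c ∷ x) (d ∷ z)
  T₄ = qshᵗ⁺ (φ ∘ (a ∷_)) (c ∷ x) ((b +ℕ d) ∷ z)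
  T₅ = qshᵗ⁺ (φ ∘ ((b +ℕ d) ∷_)) (a ∷ c ∷ x) z
  T₆ = qshᵗ⁺ (φ ∘ ((a +ℕ (b +ℕ d)) ∷_)) (c ∷ x) z
  T₇ = qshᵗ⁺ (φ ∘ ((a +ℕ c) ∷_)) x (b ∷ d ∷ z)
  T₈ = qshᵗ⁺ (φ ∘ (b ∷_)) ((a +ℕ c) ∷ x) (d ∷ z)
  T₉ = qshᵗ⁺ (φ ∘ (((a +ℕ c) +ℕ b) ∷_)) x (d ∷ z)
  T₁₀ = qshᵗ⁺ (φ ∘ ((a +ℕ c) ∷_)) x ((b +ℕ d) ∷ z)
  T₁₁ = qshᵗ⁺ (φ ∘ ((b +ℕ d) ∷_)) ((a +ℕ c) ∷ x) z
  T₁₂ = qshᵗ⁺ (φ ∘ (((a +ℕ c) +ℕ (b +ℕ d)) ∷_)) x z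
  products = ((T₁ + (T₂ + λ⁺ * T₃)) + (T₄ + (T₅ + λ⁺ * T₆))) + ((T₇ + (T₈ + λ⁺ * T₉)) + (T₁₀ + (T₁₁ + λ⁺ * T₁₂)))

a+b≡c+e⇒a+[b-e]≡c : ∀ a b c e → a + b ≡ c + e → a + (b + λ⁻ * e) ≡ c
a+b≡c+e⇒a+[b-e]≡c a b c e a+b≡c+e = begin
  a + (b + λ⁻ * e)     ≡⟨ solve 3 (λ a b e → a :+ (b :+ con (- 1ℚ) :* e) := (a :+ b) :+ con (- 1ℚ) :* e) refl a b e ⟩
  (a + b) + λ⁻ * e     ≡⟨ cong (_+ λ⁻ * e) a+b≡c+e ⟩
  (c + e) + λ⁻ * e     ≡⟨ solve 2 (λ c e → (c :+ e) :+ con (- 1ℚ) :* e := c) refl c e ⟩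
  c                    ∎

Sᵗ-combine : ∀ F G H u → Sᵗ F u + (Sᵗ G u + λ⁻ * Sᵗ H u) ≡ Sᵗ (λ w → F w + (G w + λ⁻ * H w)) u
Sᵗ-combine F G H u = sym (begin
  Sᵗ (λ w → F w + (G w + λ⁻ * H w)) u            ≡⟨ Sᵗ-+ˡ F (λ w → G w + λ⁻ * H w) u ⟩
  Sᵗ F u + Sᵗ (λ w → G w + λ⁻ * H w) u           ≡⟨ cong (Sᵗ F u +_) (Sᵗ-+ˡ G (λ w → λ⁻ * H w) u) ⟩
  Sᵗ F u + (Sᵗ G u + Sᵗ (λ w → λ⁻ * H w) u)      ≡⟨ cong (λ t → Sᵗ F u + (Sᵗ G u + t)) (Sᵗ-*ˡ λ⁻ H u) ⟩
  Sᵗ F u + (Sᵗ G u + λ⁻ * Sᵗ H u)                ∎)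

qshᵗ⁻-Sᵗ : ∀ φ K L → qshᵗ λ⁻ (Sᵗ φ) K L ≡ Sᵗ (λ K′ → Sᵗ (qshᵗ⁺ φ K′) L) K
qshᵗ⁻-Sᵗ φ [] L = refl
qshᵗ⁻-Sᵗ φ (a ∷ u) [] = Sᵗ-congˡ (λ K′ → sym (qshᵗ-[]ʳ λ⁺ φ K′)) (a ∷ u)
qshᵗ⁻-Sᵗ φ (a ∷ u) (b ∷ v) = begin
  qshᵗ λ⁻ (Sᵗ (Rᵗ a φ)) u (b ∷ v) + (qshᵗ λ⁻ (Sᵗ (Rᵗ b φ)) (a ∷ u) v + λ⁻ * qshᵗ λ⁻ (Sᵗ (Rᵗ (a +ℕ b) φ)) u v)
    ≡⟨ cong₂ _+_ (qshᵗ⁻-Sᵗ (Rᵗ a φ) u (b ∷ v))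
         (cong₂ (λ s t → s + λ⁻ * t) (qshᵗ⁻-Sᵗ (Rᵗ b φ) (a ∷ u) v) (qshᵗ⁻-Sᵗ (Rᵗ (a +ℕ b) φ) u v)) ⟩
  Sᵗ F₁ u + (Sᵗ F₂ u + λ⁻ * Sᵗ F₃ u)                  ≡⟨ Sᵗ-combine F₁ F₂ F₃ u ⟩
  Sᵗ (λ K′ → F₁ K′ + (F₂ K′ + λ⁻ * F₃ K′)) u          ≡⟨ Sᵗ-congˡ pointwise u ⟩
  Sᵗ (Rᵗ a (λ K′ → Sᵗ (Rᵗ b (qshᵗ⁺ φ K′)) v)) u       ∎
  where
  F₁ F₂ F₃ : ZWord → ℚ
  F₁ K′ = Sᵗ (Rᵗ b (qshᵗ⁺ (Rᵗ a φ) K′)) v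
  F₂ = Rᵗ a (λ K′ → Sᵗ (qshᵗ⁺ (Rᵗ b φ) K′) v)
  F₃ K′ = Sᵗ (qshᵗ⁺ (Rᵗ (a +ℕ b) φ) K′) v
  pointwise : ∀ K′ → F₁ K′ + (F₂ K′ + λ⁻ * F₃ K′) ≡ Rᵗ a (λ K″ → Sᵗ (Rᵗ b (qshᵗ⁺ φ K″)) v) K′
  pointwise K′ = begin
    F₁ K′ + (F₂ K′ + λ⁻ * F₃ K′)
      ≡⟨ cong (λ t → F₁ K′ + (t + λ⁻ * F₃ K′)) (Rᵗ-Sᵗ-comm a (qshᵗ⁺ (Rᵗ b φ)) v K′) ⟩
    F₁ K′ + (Sᵗ (λ L → Rᵗ a (λ K″ → qshᵗ⁺ (Rᵗ b φ) K″ L) K′) v + λ⁻ * F₃ K′)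
      ≡⟨ Sᵗ-combine _ _ _ v ⟩
    Sᵗ (λ L → Rᵗ b (qshᵗ⁺ (Rᵗ a φ) K′) L + (Rᵗ a (λ K″ → qshᵗ⁺ (Rᵗ b φ) K″ L) K′ + λ⁻ * qshᵗ⁺ (Rᵗ (a +ℕ b) φ) K′ L)) v
      ≡⟨ Sᵗ-congˡ (λ L → a+b≡c+e⇒a+[b-e]≡c (Rᵗ b (qshᵗ⁺ (Rᵗ a φ) K′) L) (Rᵗ a (λ K″ → qshᵗ⁺ (Rᵗ b φ) K″ L) K′) _ _
                                  (Rᵗ-qshᵗ⁺-exchange φ a b K′ L)) v ⟩
    Sᵗ (λ L → Rᵗ a (λ K″ → Rᵗ b (qshᵗ⁺ φ K″) L) K′) v
      ≡⟨ sym (Rᵗ-Sᵗ-comm a (λ K″ → Rᵗ b (qshᵗ⁺ φ K″)) v K′) ⟩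
    Rᵗ a (λ K″ → Sᵗ (Rᵗ b (qshᵗ⁺ φ K″)) v) K′ ∎

onH1 : (ZWord → ℚ) → Word → ℚ
onH1 χ w = maybe′ χ 0ℚ (parse w)

⟪∣⟫-toH1 : ∀ χ f → ⟪ χ ∣ toH1 f ⟫ ≡ ⟪ onH1 χ ∣ f ⟫
⟪∣⟫-toH1 χ [] = refl
⟪∣⟫-toH1 χ ((c , w) ∷ f) with parse w
... | just K = cong (c * χ K +_) (⟪∣⟫-toH1 χ f)
... | nothing = trans (⟪∣⟫-toH1 χ f) (sym (trans (cong (_+ ⟪ onH1 χ ∣ f ⟫) (*-zeroʳ c)) (+-identityˡ _)))

⟪∣⟫-toH1-fromH1 : ∀ χ X → ⟪ χ ∣ toH1 (fromH1 X) ⟫ ≡ ⟪ χ ∣ X ⟫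
⟪∣⟫-toH1-fromH1 χ X = begin
  ⟪ χ ∣ toH1 (fromH1 X) ⟫         ≡⟨ ⟪∣⟫-toH1 χ (fromH1 X) ⟩
  ⟪ onH1 χ ∣ fromH1 X ⟫           ≡⟨ ⟪∣⟫-mapL (onH1 χ) toWord X ⟩
  ⟪ onH1 χ ∘ toWord ∣ X ⟫         ≡⟨ ⟪∣⟫-congˡ (λ K → cong (maybe′ χ 0ℚ) (parse-toWord K)) X ⟩
  ⟪ χ ∣ X ⟫                       ∎

⟪∣⟫-fromH1 : ∀ φ X → ⟪ φ ∣ fromH1 X ⟫ ≡ ⟪ φ ∘ toWord ∣ toH1 (fromH1 X) ⟫
⟪∣⟫-fromH1 φ X = trans (⟪∣⟫-mapL φ toWord X) (sym (⟪∣⟫-toH1-fromH1 (φ ∘ toWord) X))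

⟪∣⟫-toH1-H0 : ∀ {χ ψ} f → InH0 f → (∀ K → χ K ≡ ψ (toWord K)) → ⟪ χ ∣ toH1 f ⟫ ≡ ⟪ ψ ∣ f ⟫
⟪∣⟫-toH1-H0 {χ} {ψ} f f∈H0 χ≗ψ = trans (⟪∣⟫-toH1 χ f) (⟪∣⟫-cong-H0 f f∈H0 agree)
  where
  agree : ∀ w → IsH0Word w → onH1 χ w ≡ ψ w
  agree w w∈H0 with H0-toWord w∈H0
  ... | K , refl = trans (cong (maybe′ χ 0ℚ) (parse-toWord K)) (χ≗ψ K)

⟪∣⟫-qshuffle : ∀ l φ f g → ⟪ φ ∣ qshuffle l f g ⟫ ≡ ⟪ (λ K → ⟪ qshᵗ l (φ ∘ toWord) K ∣ toH1 g ⟫) ∣ toH1 f ⟫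
⟪∣⟫-qshuffle l φ f g = begin
  ⟪ φ ∣ qshuffle l f g ⟫                                            ≡⟨ ⟪∣⟫-mapL φ toWord (bilin (qsh l) (toH1 f) (toH1 g)) ⟩
  ⟪ φ ∘ toWord ∣ bilin (qsh l) (toH1 f) (toH1 g) ⟫                  ≡⟨ ⟪∣⟫-bilin (qsh l) (φ ∘ toWord) (toH1 f) (toH1 g) ⟩
  ⟪ (λ K → ⟪ (λ L → ⟪ φ ∘ toWord ∣ qsh l K L ⟫) ∣ toH1 g ⟫) ∣ toH1 f ⟫
      ≡⟨ ⟪∣⟫-congˡ (λ K → ⟪∣⟫-congˡ (⟪∣⟫-qsh l (φ ∘ toWord) K) (toH1 g)) (toH1 f) ⟩
  ⟪ (λ K → ⟪ qshᵗ l (φ ∘ toWord) K ∣ toH1 g ⟫) ∣ toH1 f ⟫           ∎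

⟪∣⟫-shuffle-τ̃ : ∀ l φ f g →
  ⟪ φ ∣ shuffle l (τ̃ f) (τ̃ g) ⟫ ≡ ⟪ (λ a → ⟪ (λ b → ⟪ φ ∣ sh l (τ̃w a) (τ̃w b) ⟫) ∣ g ⟫) ∣ f ⟫
⟪∣⟫-shuffle-τ̃ l φ f g = begin
  ⟪ φ ∣ shuffle l (τ̃ f) (τ̃ g) ⟫                                       ≡⟨ ⟪∣⟫-bilin (sh l) φ (τ̃ f) (τ̃ g) ⟩
  ⟪ (λ a → ⟪ (λ b → ⟪ φ ∣ sh l a b ⟫) ∣ τ̃ g ⟫) ∣ τ̃ f ⟫                 ≡⟨ ⟪∣⟫-mapL _ τ̃w f ⟩
  ⟪ (λ a → ⟪ (λ b → ⟪ φ ∣ sh l (τ̃w a) b ⟫) ∣ τ̃ g ⟫) ∣ f ⟫              ≡⟨ ⟪∣⟫-congˡ (λ a → ⟪∣⟫-mapL _ τ̃w g) f ⟩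
  ⟪ (λ a → ⟪ (λ b → ⟪ φ ∣ sh l (τ̃w a) (τ̃w b) ⟫) ∣ g ⟫) ∣ f ⟫           ∎

⟪∣⟫-shuffle-τ̃τ̃ : ∀ l φ f g → ⟪ φ ∣ shuffle l (τ̃ (τ̃ f)) (τ̃ (τ̃ g)) ⟫ ≡ ⟪ φ ∣ shuffle l f g ⟫
⟪∣⟫-shuffle-τ̃τ̃ l φ f g = begin
  ⟪ φ ∣ shuffle l (τ̃ (τ̃ f)) (τ̃ (τ̃ g)) ⟫
    ≡⟨ ⟪∣⟫-shuffle-τ̃ l φ (τ̃ f) (τ̃ g) ⟩
  ⟪ (λ a → ⟪ (λ b → ⟪ φ ∣ sh l (τ̃w a) (τ̃w b) ⟫) ∣ τ̃ g ⟫) ∣ τ̃ f ⟫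
    ≡⟨ ⟪∣⟫-mapL _ τ̃w f ⟩
  ⟪ (λ a → ⟪ (λ b → ⟪ φ ∣ sh l (τ̃w (τ̃w a)) (τ̃w b) ⟫) ∣ τ̃ g ⟫) ∣ f ⟫
    ≡⟨ ⟪∣⟫-congˡ (λ a → ⟪∣⟫-mapL _ τ̃w g) f ⟩
  ⟪ (λ a → ⟪ (λ b → ⟪ φ ∣ sh l (τ̃w (τ̃w a)) (τ̃w (τ̃w b)) ⟫) ∣ g ⟫) ∣ f ⟫
      ≡⟨ ⟪∣⟫-congˡ (λ a → ⟪∣⟫-congˡ (λ b →
           cong₂ (λ a′ b′ → ⟪ φ ∣ sh l a′ b′ ⟫) (τ̃w-involutive a) (τ̃w-involutive b)) g) f ⟩
  ⟪ (λ a → ⟪ (λ b → ⟪ φ ∣ sh l a b ⟫) ∣ g ⟫) ∣ f ⟫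
    ≡⟨ sym (⟪∣⟫-bilin (sh l) φ f g) ⟩
  ⟪ φ ∣ shuffle l f g ⟫ ∎

⟪∣⟫-sh-τ̃w-toWord : ∀ l φ K L → ⟪ φ ∣ sh l (τ̃w (toWord K)) (τ̃w (toWord L)) ⟫ ≡ qshᵗ l (φ ∘ τ̃w ∘ toWord) K L
⟪∣⟫-sh-τ̃w-toWord l φ K L = begin
  ⟪ φ ∣ sh l (τ̃w (toWord K)) (τ̃w (toWord L)) ⟫
    ≡⟨ cong₂ (λ a b → ⟪ φ ∣ sh l a b ⟫) (τ̃w-toWord K) (τ̃w-toWord L) ⟩
  ⟪ φ ∣ sh l (pyWord (reverse K)) (pyWord (reverse L)) ⟫
    ≡⟨ ⟪∣⟫-sh-pyWord l φ (reverse K) (reverse L) ⟩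
  qshᵗ l (φ ∘ pyWord) (reverse K) (reverse L)
    ≡⟨ qshᵗ-reverse l (φ ∘ pyWord) K L ⟩
  qshᵗ l (φ ∘ pyWord ∘ reverse) K L
    ≡⟨ qshᵗ-congˡ l (λ M → cong φ (sym (τ̃w-toWord M))) K L ⟩
  qshᵗ l (φ ∘ τ̃w ∘ toWord) K L ∎

τ̃-qshuffle≡shuffle-τ̃-⟪∣⟫ : ∀ l φ u v → InH0 u → InH0 v →
  ⟪ φ ∣ τ̃ (qshuffle l u v) ⟫ ≡ ⟪ φ ∣ shuffle l (τ̃ u) (τ̃ v) ⟫
τ̃-qshuffle≡shuffle-τ̃-⟪∣⟫ l φ u v u∈H0 v∈H0 = begin
  ⟪ φ ∣ τ̃ (qshuffle l u v) ⟫                                          ≡⟨ ⟪∣⟫-mapL φ τ̃w (qshuffle l u v) ⟩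
  ⟪ φ ∘ τ̃w ∣ qshuffle l u v ⟫                                         ≡⟨ ⟪∣⟫-qshuffle l (φ ∘ τ̃w) u v ⟩
  ⟪ (λ K → ⟪ qshᵗ l (φ ∘ τ̃w ∘ toWord) K ∣ toH1 v ⟫) ∣ toH1 u ⟫
      ≡⟨ ⟪∣⟫-toH1-H0 u u∈H0 (λ K → ⟪∣⟫-toH1-H0 v v∈H0 (λ L → sym (⟪∣⟫-sh-τ̃w-toWord l φ K L))) ⟩
  ⟪ (λ a → ⟪ (λ b → ⟪ φ ∣ sh l (τ̃w a) (τ̃w b) ⟫) ∣ v ⟫) ∣ u ⟫          ≡⟨ sym (⟪∣⟫-shuffle-τ̃ l φ u v) ⟩
  ⟪ φ ∣ shuffle l (τ̃ u) (τ̃ v) ⟫                                       ∎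

shuffle≡τ̃-qshuffle-τ̃-⟪∣⟫ : ∀ l φ u v → InH0 u → InH0 v →
  ⟪ φ ∣ shuffle l u v ⟫ ≡ ⟪ φ ∣ τ̃ (qshuffle l (τ̃ u) (τ̃ v)) ⟫
shuffle≡τ̃-qshuffle-τ̃-⟪∣⟫ l φ u v u∈H0 v∈H0 =
  trans (sym (⟪∣⟫-shuffle-τ̃τ̃ l φ u v))
    (sym (τ̃-qshuffle≡shuffle-τ̃-⟪∣⟫ l φ (τ̃ u) (τ̃ v) (InH0-τ̃ u u∈H0) (InH0-τ̃ v v∈H0)))

⟪∣⟫-toH1-S : ∀ χ f → ⟪ χ ∣ toH1 (S f) ⟫ ≡ ⟪ Sᵗ χ ∣ toH1 f ⟫
⟪∣⟫-toH1-S χ f = trans (⟪∣⟫-toH1-fromH1 χ (concatMap _ (toH1 f)))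
  (⟪∣⟫-concatMap χ (Sᵗ χ) _ (λ c w → trans (⟪∣⟫-scaleL χ c (Sz w)) (cong (c *_) (⟪∣⟫-Sz χ w))) (toH1 f))

S-qshuffle⁻≡qshuffle⁺-S-⟪∣⟫ : ∀ φ u v → ⟪ φ ∣ S (qshuffle λ⁻ u v) ⟫ ≡ ⟪ φ ∣ qshuffle λ⁺ (S u) (S v) ⟫
S-qshuffle⁻≡qshuffle⁺-S-⟪∣⟫ φ u v = begin
  ⟪ φ ∣ S (qshuffle λ⁻ u v) ⟫
    ≡⟨ ⟪∣⟫-fromH1 φ (concatMap _ (toH1 (qshuffle λ⁻ u v))) ⟩
  ⟪ ψ ∣ toH1 (S (qshuffle λ⁻ u v)) ⟫
    ≡⟨ ⟪∣⟫-toH1-S ψ (qshuffle λ⁻ u v) ⟩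
  ⟪ Sᵗ ψ ∣ toH1 (qshuffle λ⁻ u v) ⟫
    ≡⟨ ⟪∣⟫-toH1-fromH1 (Sᵗ ψ) (bilin (qsh λ⁻) (toH1 u) (toH1 v)) ⟩
  ⟪ Sᵗ ψ ∣ bilin (qsh λ⁻) (toH1 u) (toH1 v) ⟫
    ≡⟨ ⟪∣⟫-bilin (qsh λ⁻) (Sᵗ ψ) (toH1 u) (toH1 v) ⟩
  ⟪ (λ K → ⟪ (λ L → ⟪ Sᵗ ψ ∣ qsh λ⁻ K L ⟫) ∣ toH1 v ⟫) ∣ toH1 u ⟫
      ≡⟨ ⟪∣⟫-congˡ (λ K → ⟪∣⟫-congˡ (λ L → trans (⟪∣⟫-qsh λ⁻ (Sᵗ ψ) K L) (qshᵗ⁻-Sᵗ ψ K L)) (toH1 v)) (toH1 u) ⟩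
  ⟪ (λ K → ⟪ (λ L → Sᵗ (λ K′ → Sᵗ (qshᵗ⁺ ψ K′) L) K) ∣ toH1 v ⟫) ∣ toH1 u ⟫
      ≡⟨ ⟪∣⟫-congˡ (λ K → sym (Sᵗ-⟪∣⟫-comm (λ K′ → Sᵗ (qshᵗ⁺ ψ K′)) (toH1 v) K)) (toH1 u) ⟩
  ⟪ Sᵗ (λ K′ → ⟪ Sᵗ (qshᵗ⁺ ψ K′) ∣ toH1 v ⟫) ∣ toH1 u ⟫
      ≡⟨ ⟪∣⟫-congˡ (Sᵗ-congˡ (λ K′ → sym (⟪∣⟫-toH1-S (qshᵗ⁺ ψ K′) v))) (toH1 u) ⟩
  ⟪ Sᵗ (λ K′ → ⟪ qshᵗ⁺ ψ K′ ∣ toH1 (S v) ⟫) ∣ toH1 u ⟫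
    ≡⟨ sym (⟪∣⟫-toH1-S _ u) ⟩
  ⟪ (λ K′ → ⟪ qshᵗ⁺ ψ K′ ∣ toH1 (S v) ⟫) ∣ toH1 (S u) ⟫
    ≡⟨ sym (⟪∣⟫-qshuffle λ⁺ φ (S u) (S v)) ⟩
  ⟪ φ ∣ qshuffle λ⁺ (S u) (S v) ⟫ ∎
  where
  ψ = φ ∘ toWord

corollary5p15 : (u v : Poly) → InH0 u → InH0 v →
    (shuffle λ⁻ u v ≈ τ̃ (qshuffle λ⁻ (τ̃ u) (τ̃ v)))
    × (S (qshuffle λ⁻ u v) ≈ qshuffle λ⁺ (S u) (S v))
    × (τ̃ (qshuffle λ⁺ u v) ≈ shuffle λ⁺ (τ̃ u) (τ̃ v))
corollary5p15 u v u∈H0 v∈H0 =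
    ≈-by-⟪∣⟫ (shuffle λ⁻ u v) (τ̃ (qshuffle λ⁻ (τ̃ u) (τ̃ v)))
      (λ φ → shuffle≡τ̃-qshuffle-τ̃-⟪∣⟫ λ⁻ φ u v u∈H0 v∈H0)
  , ≈-by-⟪∣⟫ (S (qshuffle λ⁻ u v)) (qshuffle λ⁺ (S u) (S v))
      (λ φ → S-qshuffle⁻≡qshuffle⁺-S-⟪∣⟫ φ u v)
  , ≈-by-⟪∣⟫ (τ̃ (qshuffle λ⁺ u v)) (shuffle λ⁺ (τ̃ u) (τ̃ v))
      (λ φ → τ̃-qshuffle≡shuffle-τ̃-⟪∣⟫ λ⁺ φ u v u∈H0 v∈H0)
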